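{- Let $p$ be an odd prime, $k\ge 2$ an integer, and $c:\mathbb{Z}_p\to\{R,G,B\}$ an exact $3$-coloring that is rainbow-free for $x-y=z^k$. Then $c(a)=c(-a)$ for every $a\in\mathbb{Z}_p$.
   Context: An exact $3$-coloring is a surjective map onto $\{R,G,B\}$. $c$ is rainbow-free for $x-y=z^k$ if there is no triple $(a_1,a_2,a_3)\in\mathbb{Z}_p^3$ with $a_1-a_2\equiv a_3^k\pmod p$ and $c(a_1),c(a_2),c(a_3)$ pairwise distinct. -}

module Defs where

open import Data.Nat using (ℕ; _+_; _∸_; _^_; _≡ᵇ_; NonZero)
open import Data.Nat.DivMod using (_%_)
open import Data.Fin using (Fin; toℕ)
open import Data.Product using (Σ; ∃; _×_)
open import Relation.Binary.PropositionalEquality using (_≡_; _≢_)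
open import Relation.Nullary using (¬_)

data Color : Set where
  R G B : Color

Exact : {p : ℕ} → (Fin p → Color) → Set
Exact {p} c = (col : Color) → ∃ λ (a : Fin p) → c a ≡ col

-- a₁ - a₂ ≡ a₃^k (mod p), expressed as a₁ ≡ a₂ + a₃^k (mod p) on residues.
SolvesEq : (p k : ℕ) .{{_ : NonZero p}} → Fin p → Fin p → Fin p → Set
SolvesEq p k a₁ a₂ a₃ = (toℕ a₂ + toℕ a₃ ^ k) % p ≡ toℕ a₁ % p

RainbowFree : (p k : ℕ) .{{_ : NonZero p}} → (Fin p → Color) → Set
RainbowFree p k c =
  (a₁ a₂ a₃ : Fin p) → SolvesEq p k a₁ a₂ a₃ →
  ¬ (c a₁ ≢ c a₂ × c a₁ ≢ c a₃ × c a₂ ≢ c a₃)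

negℕ : (p : ℕ) .{{_ : NonZero p}} → Fin p → ℕ
negℕ p a = (p ∸ toℕ a) % p

{-# OPTIONS --safe #-}
-- Suppose c(s) ≠ c(−s) for some s, let W be the third colour and D = s^k. Since
-- (−s)^k = ±D, a solution of x − y = D with c(y) = W and c(y + D) ≠ W would be
-- completed to a rainbow solution by s or −s, so the colour class of W is closed
-- under adding D. As p is prime and p ∤ s, D is invertible mod p, so this class is
-- all of ℤ_p, contradicting c(s) ≠ W.
module Submission where

open import Defs
open import Data.Nat using (ℕ; zero; suc; _+_; _*_; _∸_; _^_; _≤_; NonZero; >-nonZero⁻¹)
open import Data.Nat.Properties
  using ( +-assoc; +-comm; +-identityˡ; +-identityʳ; *-assoc; *-identityʳ; *-zeroʳ
        ; *-distribˡ-+; *-distribʳ-+; m∸n+n≡m; <⇒≤; +-commutativeSemigroup)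
open import Data.Nat.DivMod
  using ( _%_; _mod_; %-distribˡ-+; %-distribˡ-*; m%n%n≡m%n; [m+kn]%n≡m%n; m*n%n≡0
        ; m%n<n; m%n≤n; m<n⇒m%n≡m)
open import Data.Nat.Divisibility using (_∣_; ∣-refl; ∣1⇒≡1; n∣m⇒m%n≡0)
open import Data.Nat.Primality using (Prime; ¬prime[1]; euclidsLemma; prime⇒irreducible)
open import Data.Nat.Coprimality using (Coprime; coprime-Bézout)
open import Data.Nat.GCD using (module Bézout)
open import Algebra.Properties.CommutativeSemigroup +-commutativeSemigroup
  using (x∙yz≈y∙xz)
open import Data.Fin using (Fin; toℕ)
open import Data.Fin.Properties using (toℕ-injective; toℕ-fromℕ<; toℕ<n)
open import Data.Product using (_×_; _,_; ∃)
open import Data.Sum using (_⊎_; inj₁; inj₂; [_,_]′)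
open import Function using (id; _∘_)
open import Level using (0ℓ)
open import Relation.Binary using (Rel; Setoid)
open import Relation.Binary.PropositionalEquality
  using (_≡_; _≢_; refl; sym; trans; cong; cong₂; subst; module ≡-Reasoning)
open import Relation.Binary.PropositionalEquality.Properties as ≡ using ()
import Relation.Binary.Construct.On as On
import Relation.Binary.Reasoning.Setoid as SetoidReasoning
open import Relation.Nullary using (¬_; yes; no; Dec; contradiction)

_≟_ : (X Y : Color) → Dec (X ≡ Y)
R ≟ R = yes refl
R ≟ G = no λ ()
R ≟ B = no λ ()
G ≟ R = no λ ()
G ≟ G = yes refl
G ≟ B = no λ ()
B ≟ R = no λ ()
B ≟ G = no λ ()
B ≟ B = yes refl

third : (X Y : Color) → ∃ λ Z → Z ≢ X × Z ≢ Y
third R R = G , (λ ()) , (λ ())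
third R G = B , (λ ()) , (λ ())
third R B = G , (λ ()) , (λ ())
third G R = B , (λ ()) , (λ ())
third G G = R , (λ ()) , (λ ())
third G B = R , (λ ()) , (λ ())
third B R = G , (λ ()) , (λ ())
third B G = R , (λ ()) , (λ ())
third B B = R , (λ ()) , (λ ())

prime∣^⇒prime∣ : ∀ {p m} → Prime p → ∀ n → p ∣ m ^ n → p ∣ m
prime∣^⇒prime∣ pr zero p∣1 = contradiction (subst Prime (∣1⇒≡1 p∣1) pr) ¬prime[1]
prime∣^⇒prime∣ {m = m} pr (suc n) p∣m^[1+n] =
  [ id , prime∣^⇒prime∣ pr n ]′ (euclidsLemma m (m ^ n) pr p∣m^[1+n])

prime∤⇒coprime : ∀ {p n} → Prime p → ¬ p ∣ n → Coprime p n
prime∤⇒coprime pr p∤n (d∣p , d∣n) with prime⇒irreducible pr d∣p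
... | inj₁ d≡1 = d≡1
... | inj₂ refl = contradiction d∣n p∤n

module Congruence (p : ℕ) .{{_ : NonZero p}} where

  infix 4 _≈_
  _≈_ : Rel ℕ 0ℓ
  m ≈ n = m % p ≡ n % p

  ≈-setoid : Setoid 0ℓ 0ℓ
  ≈-setoid = On.setoid (≡.setoid ℕ) (_% p)

  open Setoid ≈-setoid public using () renaming (refl to ≈-refl; sym to ≈-sym; trans to ≈-trans)

  ≡⇒≈ : ∀ {m n} → m ≡ n → m ≈ n
  ≡⇒≈ = cong (_% p)

  %-≈ : ∀ m → m % p ≈ m
  %-≈ m = m%n%n≡m%n m p

  ∣⇒≈0 : ∀ {m} → p ∣ m → m ≈ 0
  ∣⇒≈0 {m} p∣m = trans (n∣m⇒m%n≡0 m p p∣m) (sym (m*n%n≡0 0 p))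

  m+kp≈m : ∀ m k → m + k * p ≈ m
  m+kp≈m m k = [m+kn]%n≡m%n m k p

  +-cong : ∀ {m n u v} → m ≈ n → u ≈ v → m + u ≈ n + v
  +-cong {m} {n} {u} {v} m≈n u≈v = begin
    (m + u) % p             ≡⟨ %-distribˡ-+ m u p ⟩
    (m % p + u % p) % p     ≡⟨ cong₂ (λ x y → (x + y) % p) m≈n u≈v ⟩
    (n % p + v % p) % p     ≡⟨ %-distribˡ-+ n v p ⟨
    (n + v) % p             ∎
    where open ≡-Reasoning

  *-cong : ∀ {m n u v} → m ≈ n → u ≈ v → m * u ≈ n * v
  *-cong {m} {n} {u} {v} m≈n u≈v = begin
    (m * u) % p             ≡⟨ %-distribˡ-* m u p ⟩
    (m % p * (u % p)) % p   ≡⟨ cong₂ (λ x y → (x * y) % p) m≈n u≈v ⟩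
    (n % p * (v % p)) % p   ≡⟨ %-distribˡ-* n v p ⟨
    (n * v) % p             ∎
    where open ≡-Reasoning

  ^-congˡ : ∀ {m n} j → m ≈ n → m ^ j ≈ n ^ j
  ^-congˡ zero    m≈n = refl
  ^-congˡ (suc j) m≈n = *-cong m≈n (^-congˡ j m≈n)

  m≤p⇒[p∸m]+m≈0 : ∀ {m} → m ≤ p → p ∸ m + m ≈ 0
  m≤p⇒[p∸m]+m≈0 m≤p = ≈-trans (≡⇒≈ (m∸n+n≡m m≤p)) (∣⇒≈0 ∣-refl)

  m+[p∸m%p]≈0 : ∀ m → m + (p ∸ m % p) ≈ 0
  m+[p∸m%p]≈0 m = begin
    m + (p ∸ m % p)        ≈⟨ +-cong (%-≈ m) ≈-refl ⟨
    m % p + (p ∸ m % p)    ≡⟨ +-comm (m % p) _ ⟩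
    p ∸ m % p + m % p      ≈⟨ m≤p⇒[p∸m]+m≈0 (m%n≤n m p) ⟩
    0                      ∎
    where open SetoidReasoning ≈-setoid

  +-cancelˡ-≈ : ∀ u {m n} → u + m ≈ u + n → m ≈ n
  +-cancelˡ-≈ u {m} {n} eq = begin
    m                      ≡⟨ +-identityˡ m ⟨
    0 + m                  ≈⟨ +-cong (m+[p∸m%p]≈0 u) ≈-refl ⟨
    u + ū + m              ≡⟨ cong (_+ m) (+-comm u ū) ⟩
    ū + u + m              ≡⟨ +-assoc ū u m ⟩
    ū + (u + m)            ≈⟨ +-cong (≈-refl {ū}) eq ⟩
    ū + (u + n)            ≡⟨ +-assoc ū u n ⟨
    ū + u + n              ≡⟨ cong (_+ n) (+-comm ū u) ⟩
    u + ū + n              ≈⟨ +-cong (m+[p∸m%p]≈0 u) ≈-refl ⟩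
    0 + n                  ≡⟨ +-identityˡ n ⟩
    n                      ∎
    where
    ū = p ∸ u % p
    open SetoidReasoning ≈-setoid

  inverse-unique : ∀ u {m n} → u + m ≈ 0 → u + n ≈ 0 → m ≈ n
  inverse-unique u m-inv n-inv = +-cancelˡ-≈ u (≈-trans m-inv (≈-sym n-inv))

  ^-of-negation : ∀ {s t} → t + s ≈ 0 → ∀ j → t ^ j ≈ s ^ j ⊎ t ^ j + s ^ j ≈ 0
  ^-of-negation t+s≈0 zero = inj₁ refl
  ^-of-negation {s} {t} t+s≈0 (suc j) with ^-of-negation t+s≈0 j
  ... | inj₁ tʲ≈sʲ = inj₂ (begin
    t * t ^ j + s * s ^ j  ≈⟨ +-cong (*-cong (≈-refl {t}) tʲ≈sʲ) ≈-refl ⟩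
    t * s ^ j + s * s ^ j  ≡⟨ *-distribʳ-+ (s ^ j) t s ⟨
    (t + s) * s ^ j        ≈⟨ *-cong t+s≈0 ≈-refl ⟩
    0                      ∎)
    where open SetoidReasoning ≈-setoid
  ... | inj₂ tʲ+sʲ≈0 = inj₁ (inverse-unique (t * s ^ j) t-side s-side)
    where
    open SetoidReasoning ≈-setoid
    t-side : t * s ^ j + t * t ^ j ≈ 0
    t-side = begin
      t * s ^ j + t * t ^ j  ≡⟨ *-distribˡ-+ t (s ^ j) (t ^ j) ⟨
      t * (s ^ j + t ^ j)    ≡⟨ cong (t *_) (+-comm (s ^ j) (t ^ j)) ⟩
      t * (t ^ j + s ^ j)    ≈⟨ *-cong (≈-refl {t}) tʲ+sʲ≈0 ⟩
      t * 0                  ≡⟨ *-zeroʳ t ⟩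
      0                      ∎
    s-side : t * s ^ j + s * s ^ j ≈ 0
    s-side = begin
      t * s ^ j + s * s ^ j  ≡⟨ *-distribʳ-+ (s ^ j) t s ⟨
      (t + s) * s ^ j        ≈⟨ *-cong t+s≈0 ≈-refl ⟩
      0                      ∎

  coprime⇒invertible : ∀ {d} → Coprime p d → ∃ λ i → i * d ≈ 1
  coprime⇒invertible {d} coprime with coprime-Bézout coprime
  ... | Bézout.-+ x y 1+xp≡yd = y , ≈-trans (≡⇒≈ (sym 1+xp≡yd)) (m+kp≈m 1 x)
  ... | Bézout.+- x y 1+yd≡xp = (p ∸ 1) * y , inverse-unique (p ∸ 1) i-side 1-side
    where
    open SetoidReasoning ≈-setoid
    i-side : p ∸ 1 + (p ∸ 1) * y * d ≈ 0
    i-side = begin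
      p ∸ 1 + (p ∸ 1) * y * d        ≡⟨ cong₂ _+_ (sym (*-identityʳ (p ∸ 1))) (*-assoc (p ∸ 1) y d) ⟩
      (p ∸ 1) * 1 + (p ∸ 1) * (y * d) ≡⟨ *-distribˡ-+ (p ∸ 1) 1 (y * d) ⟨
      (p ∸ 1) * (1 + y * d)          ≡⟨ cong ((p ∸ 1) *_) 1+yd≡xp ⟩
      (p ∸ 1) * (x * p)              ≈⟨ *-cong (≈-refl {p ∸ 1}) (m+kp≈m 0 x) ⟩
      (p ∸ 1) * 0                    ≡⟨ *-zeroʳ (p ∸ 1) ⟩
      0                              ∎
    1-side : p ∸ 1 + 1 ≈ 0
    1-side = m≤p⇒[p∸m]+m≈0 (>-nonZero⁻¹ p)

  coprime⇒translate : ∀ {d} → Coprime p d → ∀ y x → ∃ λ j → y + j * d ≈ x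
  coprime⇒translate {d} coprime y x with coprime⇒invertible coprime
  ... | i , i*d≈1 = (x + ȳ) * i , (begin
    y + (x + ȳ) * i * d     ≡⟨ cong (y +_) (*-assoc (x + ȳ) i d) ⟩
    y + (x + ȳ) * (i * d)   ≈⟨ +-cong (≈-refl {y}) (*-cong (≈-refl {x + ȳ}) i*d≈1) ⟩
    y + (x + ȳ) * 1         ≡⟨ cong (y +_) (*-identityʳ (x + ȳ)) ⟩
    y + (x + ȳ)             ≡⟨ x∙yz≈y∙xz y x ȳ ⟩
    x + (y + ȳ)             ≈⟨ +-cong (≈-refl {x}) (m+[p∸m%p]≈0 y) ⟩
    x + 0                   ≡⟨ +-identityʳ x ⟩
    x                       ∎)
    where
    ȳ = p ∸ y % p
    open SetoidReasoning ≈-setoid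

module RainbowFreeColouring (p k : ℕ) .{{_ : NonZero p}} (c : Fin p → Color)
                            (rainbowFree : RainbowFree p k c) where
  open Congruence p

  colour : ℕ → Color
  colour n = c (n mod p)

  toℕ-mod : ∀ m → toℕ (m mod p) ≡ m % p
  toℕ-mod m = toℕ-fromℕ< (m%n<n m p)

  colour-cong : ∀ {m n} → m ≈ n → colour m ≡ colour n
  colour-cong {m} {n} m≈n =
    cong c (toℕ-injective (trans (toℕ-mod m) (trans m≈n (sym (toℕ-mod n)))))

  colour-toℕ : (a : Fin p) → colour (toℕ a) ≡ c a
  colour-toℕ a = cong c (toℕ-injective (trans (toℕ-mod (toℕ a)) (m<n⇒m%n≡m (toℕ<n a))))

  non-rainbow : ∀ {x y z} → x ≈ y + z ^ k →
                colour x ≢ colour y → colour y ≢ colour z → colour x ≡ colour z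
  non-rainbow {x} {y} {z} x≈y+zᵏ x≢y y≢z with colour x ≟ colour z
  ... | yes x≡z = x≡z
  ... | no x≢z = contradiction (x≢y , x≢z , y≢z) (rainbowFree (x mod p) (y mod p) (z mod p) solves)
    where
    open SetoidReasoning ≈-setoid
    solves : SolvesEq p k (x mod p) (y mod p) (z mod p)
    solves = begin
      toℕ (y mod p) + toℕ (z mod p) ^ k  ≡⟨ cong₂ (λ u v → u + v ^ k) (toℕ-mod y) (toℕ-mod z) ⟩
      y % p + (z % p) ^ k                ≈⟨ +-cong (%-≈ y) (^-congˡ k (%-≈ z)) ⟩
      y + z ^ k                          ≈⟨ x≈y+zᵏ ⟨
      x                                  ≈⟨ %-≈ x ⟨
      x % p                              ≡⟨ toℕ-mod x ⟨
      toℕ (x mod p)                      ∎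

  module ThirdColourClass {s t : ℕ} {W : Color} (s≢t : colour s ≢ colour t)
                          (W≢s : W ≢ colour s) (W≢t : W ≢ colour t)
                          (tᵏ≈±sᵏ : t ^ k ≈ s ^ k ⊎ t ^ k + s ^ k ≈ 0) where

    +sᵏ-closed : ∀ y → colour y ≡ W → colour (y + s ^ k) ≡ W
    +sᵏ-closed y y↦W with colour (y + s ^ k) ≟ W
    ... | yes y+sᵏ↦W = y+sᵏ↦W
    ... | no ¬y+sᵏ↦W = [ rainbow-via-t , rainbow-via-t-reversed ]′ tᵏ≈±sᵏ
      where
      y+sᵏ≢y : colour (y + s ^ k) ≢ colour y
      y+sᵏ≢y eq = ¬y+sᵏ↦W (trans eq y↦W)

      y≢t : colour y ≢ colour t
      y≢t eq = W≢t (trans (sym y↦W) eq)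

      y+sᵏ↦s : colour (y + s ^ k) ≡ colour s
      y+sᵏ↦s = non-rainbow ≈-refl y+sᵏ≢y (λ eq → W≢s (trans (sym y↦W) eq))

      rainbow-via-t : t ^ k ≈ s ^ k → colour (y + s ^ k) ≡ W
      rainbow-via-t tᵏ≈sᵏ = contradiction
        (trans (sym y+sᵏ↦s) (non-rainbow (+-cong (≈-refl {y}) (≈-sym tᵏ≈sᵏ)) y+sᵏ≢y y≢t)) s≢t

      rainbow-via-t-reversed : t ^ k + s ^ k ≈ 0 → colour (y + s ^ k) ≡ W
      rainbow-via-t-reversed tᵏ+sᵏ≈0 = contradiction
        (non-rainbow y≈y+sᵏ+tᵏ (λ eq → y+sᵏ≢y (sym eq)) (λ eq → s≢t (trans (sym y+sᵏ↦s) eq)))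
        y≢t
        where
        open SetoidReasoning ≈-setoid
        y≈y+sᵏ+tᵏ : y ≈ y + s ^ k + t ^ k
        y≈y+sᵏ+tᵏ = ≈-sym (begin
          y + s ^ k + t ^ k    ≡⟨ +-assoc y (s ^ k) (t ^ k) ⟩
          y + (s ^ k + t ^ k)  ≡⟨ cong (y +_) (+-comm (s ^ k) (t ^ k)) ⟩
          y + (t ^ k + s ^ k)  ≈⟨ +-cong (≈-refl {y}) tᵏ+sᵏ≈0 ⟩
          y + 0                ≡⟨ +-identityʳ y ⟩
          y                    ∎)

    +j*sᵏ-closed : ∀ j y → colour y ≡ W → colour (y + j * s ^ k) ≡ W
    +j*sᵏ-closed zero    y y↦W = trans (cong colour (+-identityʳ y)) y↦W
    +j*sᵏ-closed (suc j) y y↦W = trans (cong colour (sym (+-assoc y (s ^ k) (j * s ^ k))))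
                                       (+j*sᵏ-closed j (y + s ^ k) (+sᵏ-closed y y↦W))

    coprime⇒everything↦W : Coprime p (s ^ k) → ∀ y x → colour y ≡ W → colour x ≡ W
    coprime⇒everything↦W coprime y x y↦W with coprime⇒translate coprime y x
    ... | j , y+j*sᵏ≈x = trans (sym (colour-cong y+j*sᵏ≈x)) (+j*sᵏ-closed j y y↦W)

  colour-negation : Prime p → Exact c → ∀ {s t} → t + s ≈ 0 → colour s ≡ colour t
  colour-negation pr exact {s} {t} t+s≈0 with colour s ≟ colour t
  ... | yes s≡t = s≡t
  ... | no s≢t with third (colour s) (colour t)
  ...   | W , W≢s , W≢t with exact W
  ...     | w , w↦W = contradiction (sym s↦W) W≢s
    where
    open ThirdColourClass s≢t W≢s W≢t (^-of-negation t+s≈0 k)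

    p∤s : ¬ p ∣ s
    p∤s p∣s = s≢t (colour-cong (begin
      s      ≈⟨ ∣⇒≈0 p∣s ⟩
      0      ≈⟨ t+s≈0 ⟨
      t + s  ≈⟨ +-cong (≈-refl {t}) (∣⇒≈0 p∣s) ⟩
      t + 0  ≡⟨ +-identityʳ t ⟩
      t      ∎))
      where open SetoidReasoning ≈-setoid

    s↦W : colour s ≡ W
    s↦W = coprime⇒everything↦W (prime∤⇒coprime pr (p∤s ∘ prime∣^⇒prime∣ pr k))
                               (toℕ w) s (trans (colour-toℕ w) w↦W)

mainTheorem17 : (p k : ℕ) .{{_ : NonZero p}} → Prime p → p ≢ 2 → 2 ≤ k →
    (c : Fin p → Color) → Exact c → RainbowFree p k c →
    (a b : Fin p) → toℕ b ≡ negℕ p a → c a ≡ c b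
mainTheorem17 p k pr _ _ c exact rainbowFree a b b≡-a = begin
  c a             ≡⟨ colour-toℕ a ⟨
  colour (toℕ a)  ≡⟨ colour-negation pr exact b+a≈0 ⟩
  colour (toℕ b)  ≡⟨ colour-toℕ b ⟩
  c b             ∎
  where
  open Congruence p
  open RainbowFreeColouring p k c rainbowFree
  open ≡-Reasoning

  b+a≈0 : toℕ b + toℕ a ≈ 0
  b+a≈0 = ≈-trans (+-cong (≈-trans (≡⇒≈ b≡-a) (%-≈ _)) ≈-refl) (m≤p⇒[p∸m]+m≈0 (<⇒≤ (toℕ<n a)))
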